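{- For every $w\in\mathfrak{h}^0$ we have $$\partial_2(w)=w\,\square\,z_2-w\ast z_2,$$ where $z_2=x_0x_1$.
   Context: Let $\mathfrak{h}=\mathbb{Q}\langle x_0,x_1\rangle$ be the free noncommutative polynomial algebra (concatenation product, unit $\mathbf{1}$). Let $\mathfrak{h}^1=\mathbb{Q}\mathbf{1}\oplus\mathfrak{h}x_1$ (words not ending in $x_0$), $\mathfrak{h}^{(-1)}=\mathbb{Q}\mathbf{1}\oplus x_0\mathfrak{h}$ (words not beginning with $x_1$), and $\mathfrak{h}^0=\mathbb{Q}\mathbf{1}\oplus x_0\mathfrak{h}x_1$. For $k\ge1$ put $z_k:=x_0^{k-1}x_1$, so $\mathfrak{h}^1=\mathbb{Q}\langle z_k:k\ge1\rangle$. The quasi-shuffle product $\ast$ on $\mathfrak{h}^1$ is the bilinear product defined by $\mathbf{1}\ast w=w\ast\mathbf{1}=w$ and $z_nu\ast z_mv=z_n(u\ast z_mv)+z_m(z_nu\ast v)+z_{n+m}(u\ast v)$ for words $u,v$ and $n,m\ge1$. Let $\tau$ be the unique anti-automorphism of $\mathfrak{h}$ with $\tau(x_0)=x_1$, $\tau(x_1)=x_0$; it is an involution mapping $\mathfrak{h}^{(-1)}$ onto $\mathfrak{h}^1$ and $\mathfrak{h}^0$ onto itself. Define the product $\square$ on $\mathfrak{h}^{(-1)}$ by $u\,\square\,v:=\tau(\tau(u)\ast\tau(v))$. Let $\partial_2$ be the derivation of the concatenation algebra $\mathfrak{h}$ determined by $\partial_2(x_0)=x_0(x_0+x_1)x_1$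 and $\partial_2(x_1)=-x_0(x_0+x_1)x_1$. -}

module Defs where

open import Data.Rational using (ℚ; 0ℚ; 1ℚ; _+_; _*_; -_)
open import Data.List using (List; []; _∷_; [_]; _++_; map; concatMap; reverse; replicate)
open import Data.List.Properties using (≡-dec)
open import Data.Product using (_×_; _,_; ∃)
open import Data.Sum using (_⊎_)
open import Data.Nat as ℕ using (ℕ; zero; suc; _∸_)
open import Data.Maybe using (Maybe; just; nothing)
open import Relation.Nullary using (¬_; yes; no)
open import Relation.Binary.PropositionalEquality using (_≡_; refl)
open import Relation.Binary.Definitions using (DecidableEquality)

data Letter : Set where
  x₀ x₁ : Letter

_≟L_ : DecidableEquality Letter
x₀ ≟L x₀ = yes refl
x₀ ≟L x₁ = no (λ ())
x₁ ≟L x₀ = no (λ ())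
x₁ ≟L x₁ = yes refl

Word : Set
Word = List Letter

_≟W_ : DecidableEquality Word
_≟W_ = ≡-dec _≟L_

-- 𝔥 = ℚ⟨x₀,x₁⟩ : finite formal ℚ-linear combinations of words,
-- compared by their coefficient functions.

Poly : Set
Poly = List (ℚ × Word)

coeff : Poly → Word → ℚ
coeff [] u = 0ℚ
coeff ((c , v) ∷ p) u with v ≟W u
... | yes _ = c + coeff p u
... | no  _ = coeff p u

infix 4 _≈_
_≈_ : Poly → Poly → Set
p ≈ q = ∀ u → coeff p u ≡ coeff q u

word : Word → Poly
word u = [ (1ℚ , u) ]

infixl 6 _⊕_ _⊖_
infixr 7 _⊙_
infixl 8 _·_

_⊕_ : Poly → Poly → Poly
p ⊕ q = p ++ q

_⊙_ : ℚ → Poly → Poly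
c ⊙ p = map (λ { (d , u) → (c * d , u) }) p

_⊖_ : Poly → Poly → Poly
p ⊖ q = p ⊕ ((- 1ℚ) ⊙ q)

bilinear : (Word → Word → Poly) → Poly → Poly → Poly
bilinear f p q =
  concatMap (λ { (c , u) → concatMap (λ { (d , v) → (c * d) ⊙ f u v }) q }) p

linear : (Word → Poly) → Poly → Poly
linear f p = concatMap (λ { (c , u) → c ⊙ f u }) p

_·_ : Poly → Poly → Poly
_·_ = bilinear (λ u v → word (u ++ v))

z : ℕ → Word
z k = replicate (k ∸ 1) x₀ ++ [ x₁ ]

-- parse a word of 𝔥¹ as z_{k₁} ⋯ z_{kₙ}; nothing if the word ends in x₀
parseZ : ℕ → Word → Maybe (List ℕ)
parseZ zero    []       = just []
parseZ (suc n) []       = nothing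
parseZ n       (x₀ ∷ w) = parseZ (suc n) w
parseZ n       (x₁ ∷ w) with parseZ zero w
... | just ks = just (suc n ∷ ks)
... | nothing = nothing

zPrefix : ℕ → Poly → Poly
zPrefix n p = map (λ { (c , u) → (c , z n ++ u) }) p

-- quasi-shuffle on words z_{k₁}⋯z_{kₙ}, given by their index lists
qsh : List ℕ → List ℕ → Poly
qsh [] v = word (Data.List.concatMap z v)
qsh (n ∷ u) [] = word (Data.List.concatMap z (n ∷ u))
qsh (n ∷ u) (m ∷ v) =
  zPrefix n (qsh u (m ∷ v)) ⊕ zPrefix m (qsh (n ∷ u) v) ⊕ zPrefix (n ℕ.+ m) (qsh u v)

-- quasi-shuffle product on words of 𝔥¹ (convention: 0 outside 𝔥¹,
-- where ∗ is not defined in the paper; never used in the theorem)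
astW : Word → Word → Poly
astW u v with parseZ zero u | parseZ zero v
... | just a | just b = qsh a b
... | _      | _      = []

infixl 7 _∗_ _□_
_∗_ : Poly → Poly → Poly
_∗_ = bilinear astW

swapL : Letter → Letter
swapL x₀ = x₁
swapL x₁ = x₀

τW : Word → Word
τW u = reverse (map swapL u)

τ : Poly → Poly
τ p = map (λ { (c , u) → (c , τW u) }) p

_□_ : Poly → Poly → Poly
u □ v = τ (τ u ∗ τ v)

∂₂L : Letter → Poly
∂₂L x₀ = word [ x₀ ] · (word [ x₀ ] ⊕ word [ x₁ ]) · word [ x₁ ]
∂₂L x₁ = (- 1ℚ) ⊙ (word [ x₀ ] · (word [ x₀ ] ⊕ word [ x₁ ]) · word [ x₁ ])

∂₂W : Word → Poly
∂₂W []      = []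
∂₂W (a ∷ w) = ∂₂L a · word w ⊕ word [ a ] · ∂₂W w

∂₂ : Poly → Poly
∂₂ = linear ∂₂W

InH0W : Word → Set
InH0W u = (u ≡ []) ⊎ ∃ (λ v → u ≡ x₀ ∷ (v ++ [ x₁ ]))

InH0 : Poly → Set
InH0 w = ∀ u → ¬ InH0W u → coeff w u ≡ 0ℚ

z₂ : Poly
z₂ = word (x₀ ∷ x₁ ∷ [])

-- Both sides are linear in w, and a linear form on 𝔥 only depends on coefficients, so it
-- suffices to compare the two sides against every linear form on a single word u ∈ 𝔥⁰.
-- Each side is then a weighted sum, over the gaps of u, of u with a two-letter word
-- inserted in that gap.  ∂₂ inserts x₀x₁ + x₁x₁ after every x₀ and removes x₀x₀ + x₀x₁
-- before every x₁.  Writing u = z_{k₁}⋯z_{kₙ}, u ∗ z₂ inserts z₂ into every gap not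
-- following an x₀ and x₀x₀ before every x₁ (this is z_k ↦ z_{k+2}); since τu ∈ 𝔥¹ as well,
-- applying τ shows that u □ z₂ inserts z₂ into every gap not preceding an x₁ and x₁x₁
-- after every x₀.  The x₀x₀ and x₁x₁ terms agree on both sides, and for z₂ = x₀x₁ the
-- weights agree because [after x₀] − [before x₁] = [not before x₁] − [not after x₀].

module Submission where

open import Data.Empty using (⊥-elim)
open import Data.List.Base
  using (List; []; _∷_; [_]; _++_; map; concatMap; replicate; reverse; length; initLast; _∷ʳ′_)
open import Data.List.Properties
  using (++-assoc; map-++; map-∘; map-cong; map-id; reverse-++; reverse-map; reverse-involutive;
         ∷-injectiveʳ; ∷ʳ-injective)
import Data.Maybe.Base as Maybe
open import Data.Maybe.Base using (Maybe; just; nothing)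
open import Data.Nat.Base using (ℕ; zero; suc; _≤_; s≤s) renaming (_+_ to _+ℕ_)
open import Data.Nat.Properties using (≤-refl; ≤-trans; m≤n⇒m≤1+n; +-suc; +-identityʳ)
open import Data.Product.Base using (∃; ∃₂; _,_; proj₁; proj₂)
open import Data.Rational.Base using (ℚ; 0ℚ; 1ℚ; _+_; _*_; -_)
import Data.Rational.Properties as ℚ
open import Data.Sum.Base using (inj₁; inj₂)
open import Function.Base using (_∘_)
open import Level using (0ℓ)
open import Relation.Binary.PropositionalEquality
  using (_≡_; _≢_; refl; sym; trans; cong; cong₂; module ≡-Reasoning)
open import Relation.Nullary using (¬_; yes; no)
open import Relation.Nullary.Decidable using (dec⇒maybe)
open import Relation.Unary using (Decidable)
open import Tactic.RingSolver using (solve-∀)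
import Tactic.RingSolver.Core.AlmostCommutativeRing as ACR

open import Defs

open ≡-Reasoning

ℚ-ring : ACR.AlmostCommutativeRing 0ℓ 0ℓ
ℚ-ring = ACR.fromCommutativeRing ℚ.+-*-commutativeRing (dec⇒maybe ∘ (0ℚ ℚ.≟_))

-- Linear forms on 𝔥

⟪_∣_⟫ : (Word → ℚ) → Poly → ℚ
⟪ h ∣ [] ⟫           = 0ℚ
⟪ h ∣ (c , u) ∷ p ⟫ = c * h u + ⟪ h ∣ p ⟫

infix 4 _≋_
_≋_ : Poly → Poly → Set
p ≋ q = ∀ h → ⟪ h ∣ p ⟫ ≡ ⟪ h ∣ q ⟫

⟪⟫-++ : ∀ h p q → ⟪ h ∣ p ++ q ⟫ ≡ ⟪ h ∣ p ⟫ + ⟪ h ∣ q ⟫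
⟪⟫-++ h []            q = sym (ℚ.+-identityˡ _)
⟪⟫-++ h ((c , u) ∷ p) q =
  trans (cong (c * h u +_) (⟪⟫-++ h p q)) (sym (ℚ.+-assoc (c * h u) _ _))

⟪⟫-⊙ : ∀ h c p → ⟪ h ∣ c ⊙ p ⟫ ≡ c * ⟪ h ∣ p ⟫
⟪⟫-⊙ h c []            = sym (ℚ.*-zeroʳ c)
⟪⟫-⊙ h c ((d , u) ∷ p) = begin
  c * d * h u + ⟪ h ∣ c ⊙ p ⟫    ≡⟨ cong₂ _+_ (ℚ.*-assoc c d (h u)) (⟪⟫-⊙ h c p) ⟩
  c * (d * h u) + c * ⟪ h ∣ p ⟫  ≡⟨ sym (ℚ.*-distribˡ-+ c _ _) ⟩
  c * (d * h u + ⟪ h ∣ p ⟫)      ∎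

⟪⟫-⊖ : ∀ h p q → ⟪ h ∣ p ⊖ q ⟫ ≡ ⟪ h ∣ p ⟫ + - 1ℚ * ⟪ h ∣ q ⟫
⟪⟫-⊖ h p q = trans (⟪⟫-++ h p _) (cong (⟪ h ∣ p ⟫ +_) (⟪⟫-⊙ h (- 1ℚ) q))

⟪⟫-word : ∀ h u → ⟪ h ∣ word u ⟫ ≡ h u
⟪⟫-word h u = trans (ℚ.+-identityʳ _) (ℚ.*-identityˡ (h u))

⟪⟫-cong : ∀ {h h'} → (∀ u → h u ≡ h' u) → ∀ p → ⟪ h ∣ p ⟫ ≡ ⟪ h' ∣ p ⟫
⟪⟫-cong h≗h' []            = refl
⟪⟫-cong h≗h' ((c , u) ∷ p) = cong₂ (λ a b → c * a + b) (h≗h' u) (⟪⟫-cong h≗h' p)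

⟪⟫-* : ∀ c h p → ⟪ (λ u → c * h u) ∣ p ⟫ ≡ c * ⟪ h ∣ p ⟫
⟪⟫-* c h []            = sym (ℚ.*-zeroʳ c)
⟪⟫-* c h ((d , u) ∷ p) = trans (cong (d * (c * h u) +_) (⟪⟫-* c h p)) (factor c d (h u) _)
  where
  factor : ∀ c d a s → d * (c * a) + c * s ≡ c * (d * a + s)
  factor = solve-∀ ℚ-ring

⟪⟫-+* : ∀ h c h' p → ⟪ (λ u → h u + c * h' u) ∣ p ⟫ ≡ ⟪ h ∣ p ⟫ + c * ⟪ h' ∣ p ⟫
⟪⟫-+* h c h' []            = sym (trans (ℚ.+-identityˡ (c * 0ℚ)) (ℚ.*-zeroʳ c))
⟪⟫-+* h c h' ((d , u) ∷ p) =
  trans (cong (d * (h u + c * h' u) +_) (⟪⟫-+* h c h' p)) (regroup d (h u) c (h' u) _ _)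
  where
  regroup : ∀ d a c b s t → d * (a + c * b) + (s + c * t) ≡ (d * a + s) + c * (d * b + t)
  regroup = solve-∀ ℚ-ring

mapWords : (Word → Word) → Poly → Poly
mapWords f p = map (λ { (c , u) → (c , f u) }) p

⟪⟫-mapWords : ∀ h f p → ⟪ h ∣ mapWords f p ⟫ ≡ ⟪ h ∘ f ∣ p ⟫
⟪⟫-mapWords h f []            = refl
⟪⟫-mapWords h f ((c , u) ∷ p) = cong (c * h (f u) +_) (⟪⟫-mapWords h f p)

⟪⟫-concatMap : ∀ {h g k} → (∀ c u → ⟪ h ∣ g (c , u) ⟫ ≡ c * k u) →
               ∀ p → ⟪ h ∣ concatMap g p ⟫ ≡ ⟪ k ∣ p ⟫
⟪⟫-concatMap         g≡ []            = refl
⟪⟫-concatMap {h} {g} g≡ ((c , u) ∷ p) =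
  trans (⟪⟫-++ h (g (c , u)) _) (cong₂ _+_ (g≡ c u) (⟪⟫-concatMap g≡ p))

⟪⟫-linear : ∀ h f p → ⟪ h ∣ linear f p ⟫ ≡ ⟪ (λ u → ⟪ h ∣ f u ⟫) ∣ p ⟫
⟪⟫-linear h f = ⟪⟫-concatMap (λ c u → ⟪⟫-⊙ h c (f u))

⟪⟫-bilinear : ∀ h f p q →
  ⟪ h ∣ bilinear f p q ⟫ ≡ ⟪ (λ u → ⟪ (λ v → ⟪ h ∣ f u v ⟫) ∣ q ⟫) ∣ p ⟫
⟪⟫-bilinear h f p q = ⟪⟫-concatMap
  (λ c u → trans (⟪⟫-concatMap (λ d v → trans (⟪⟫-⊙ h (c * d) (f u v)) (swap c d _)) q)
                 (⟪⟫-* c (λ v → ⟪ h ∣ f u v ⟫) q))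
  p
  where
  swap : ∀ c d a → c * d * a ≡ d * (c * a)
  swap = solve-∀ ℚ-ring

⟪⟫-∗word : ∀ h p v → ⟪ h ∣ p ∗ word v ⟫ ≡ ⟪ (λ u → ⟪ h ∣ astW u v ⟫) ∣ p ⟫
⟪⟫-∗word h p v =
  trans (⟪⟫-bilinear h astW p (word v)) (⟪⟫-cong (λ u → ⟪⟫-word (λ v → ⟪ h ∣ astW u v ⟫) v) p)

⟪⟫-word· : ∀ h a q → ⟪ h ∣ word a · q ⟫ ≡ ⟪ h ∘ (a ++_) ∣ q ⟫
⟪⟫-word· h a q = trans (⟪⟫-bilinear h (λ u v → word (u ++ v)) (word a) q)
  (trans (⟪⟫-word (λ u → ⟪ (λ v → ⟪ h ∣ word (u ++ v) ⟫) ∣ q ⟫) a)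
         (⟪⟫-cong (λ v → ⟪⟫-word h (a ++ v)) q))

coeff-∷-≢ : ∀ {u v} c p → u ≢ v → coeff ((c , u) ∷ p) v ≡ coeff p v
coeff-∷-≢ {u} {v} c p u≢v with u ≟W v
... | yes u≡v = ⊥-elim (u≢v u≡v)
... | no  _   = refl

coeff-∷ : ∀ c v p x → coeff ((c , v) ∷ p) x ≡ c * coeff (word v) x + coeff p x
coeff-∷ c v p x with v ≟W x
... | yes _ = cong (_+ coeff p x) (sym (ℚ.*-identityʳ c))
... | no  _ = sym (trans (cong (_+ coeff p x) (ℚ.*-zeroʳ c)) (ℚ.+-identityˡ _))

coeff≡⟪⟫ : ∀ p x → coeff p x ≡ ⟪ (λ v → coeff (word v) x) ∣ p ⟫
coeff≡⟪⟫ []            x = refl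
coeff≡⟪⟫ ((c , v) ∷ p) x = trans (coeff-∷ c v p x) (cong (c * coeff (word v) x +_) (coeff≡⟪⟫ p x))

≋⇒≈ : ∀ {p q} → p ≋ q → p ≈ q
≋⇒≈ {p} {q} p≋q x = trans (coeff≡⟪⟫ p x) (trans (p≋q _) (sym (coeff≡⟪⟫ q x)))

without : Word → Poly → Poly
without v [] = []
without v ((c , u) ∷ p) with u ≟W v
... | yes _ = without v p
... | no  _ = (c , u) ∷ without v p

⟪⟫-without : ∀ h v p → ⟪ h ∣ p ⟫ ≡ coeff p v * h v + ⟪ h ∣ without v p ⟫
⟪⟫-without h v [] = sym (trans (cong (_+ 0ℚ) (ℚ.*-zeroˡ (h v))) (ℚ.+-identityˡ 0ℚ))
⟪⟫-without h v ((c , u) ∷ p) with u ≟W v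
... | yes refl = trans (cong (c * h v +_) (⟪⟫-without h v p)) (collect c (coeff p v) (h v) _)
  where
  collect : ∀ c a x s → c * x + (a * x + s) ≡ (c + a) * x + s
  collect = solve-∀ ℚ-ring
... | no  _    = trans (cong (c * h u +_) (⟪⟫-without h v p)) (exchange (c * h u) (coeff p v * h v) _)
  where
  exchange : ∀ a b s → a + (b + s) ≡ b + (a + s)
  exchange = solve-∀ ℚ-ring

coeff-without-self : ∀ v p → coeff (without v p) v ≡ 0ℚ
coeff-without-self v [] = refl
coeff-without-self v ((c , u) ∷ p) with u ≟W v
... | yes _   = coeff-without-self v p
... | no  u≢v = trans (coeff-∷-≢ c (without v p) u≢v) (coeff-without-self v p)

coeff-without-≢ : ∀ {u v} → u ≢ v → ∀ p → coeff (without v p) u ≡ coeff p u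
coeff-without-≢ u≢v [] = refl
coeff-without-≢ {u} {v} u≢v ((c , w) ∷ p) with w ≟W v
... | yes refl = trans (coeff-without-≢ u≢v p) (sym (coeff-∷-≢ c p (u≢v ∘ sym)))
... | no  _    = trans (coeff-∷ c w (without v p) u)
  (trans (cong (c * coeff (word w) u +_) (coeff-without-≢ u≢v p)) (sym (coeff-∷ c w p u)))

length-without : ∀ v p → length (without v p) ≤ length p
length-without v [] = ≤-refl
length-without v ((c , u) ∷ p) with u ≟W v
... | yes _ = m≤n⇒m≤1+n (length-without v p)
... | no  _ = s≤s (length-without v p)

length-without-∷ : ∀ c v p → length (without v ((c , v) ∷ p)) ≤ length p
length-without-∷ c v p with v ≟W v
... | yes _   = length-without v p
... | no  v≢v = ⊥-elim (v≢v refl)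

⟪⟫-null : ∀ {h} p → (∀ u → coeff p u * h u ≡ 0ℚ) → ⟪ h ∣ p ⟫ ≡ 0ℚ
⟪⟫-null {h} p = go p ≤-refl
  where
  go : ∀ {n} p → length p ≤ n → (∀ u → coeff p u * h u ≡ 0ℚ) → ⟪ h ∣ p ⟫ ≡ 0ℚ
  go []            _           _    = refl
  go {suc n} ((c , v) ∷ p) (s≤s |p|≤n) null = begin
    ⟪ h ∣ (c , v) ∷ p ⟫                                 ≡⟨ ⟪⟫-without h v ((c , v) ∷ p) ⟩
    coeff ((c , v) ∷ p) v * h v + ⟪ h ∣ rest ⟫
      ≡⟨ cong₂ _+_ (null v) (go rest (≤-trans (length-without-∷ c v p) |p|≤n) null-rest) ⟩
    0ℚ + 0ℚ                                             ≡⟨ ℚ.+-identityˡ 0ℚ ⟩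
    0ℚ                                                  ∎
    where
    rest : Poly
    rest = without v ((c , v) ∷ p)
    null-rest : ∀ u → coeff rest u * h u ≡ 0ℚ
    null-rest u with u ≟W v
    ... | yes refl = trans (cong (_* h u) (coeff-without-self u ((c , u) ∷ p))) (ℚ.*-zeroˡ (h u))
    ... | no  u≢v  = trans (cong (_* h u) (coeff-without-≢ u≢v ((c , v) ∷ p))) (null u)

⟪⟫-on-support : ∀ {P : Word → Set} → Decidable P → ∀ {h h'} p →
  (∀ u → ¬ P u → coeff p u ≡ 0ℚ) → (∀ u → P u → h u ≡ h' u) →
  ⟪ h ∣ p ⟫ ≡ ⟪ h' ∣ p ⟫
⟪⟫-on-support P? {h} {h'} p p⊆P h≡h'-on-P = begin
  ⟪ h ∣ p ⟫                                     ≡⟨ split ⟪ h ∣ p ⟫ ⟪ h' ∣ p ⟫ ⟩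
  (⟪ h ∣ p ⟫ + - 1ℚ * ⟪ h' ∣ p ⟫) + ⟪ h' ∣ p ⟫   ≡⟨ cong (_+ ⟪ h' ∣ p ⟫) difference≡0 ⟩
  0ℚ + ⟪ h' ∣ p ⟫                               ≡⟨ ℚ.+-identityˡ _ ⟩
  ⟪ h' ∣ p ⟫                                    ∎
  where
  split : ∀ a b → a ≡ (a + - 1ℚ * b) + b
  split = solve-∀ ℚ-ring
  cancel : ∀ c b → c * (b + - 1ℚ * b) ≡ 0ℚ
  cancel = solve-∀ ℚ-ring
  vanishes : ∀ u → coeff p u * (h u + - 1ℚ * h' u) ≡ 0ℚ
  vanishes u with P? u
  ... | yes Pu  = trans (cong (λ a → coeff p u * (a + - 1ℚ * h' u)) (h≡h'-on-P u Pu))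
                        (cancel (coeff p u) (h' u))
  ... | no  ¬Pu = trans (cong (_* (h u + - 1ℚ * h' u)) (p⊆P u ¬Pu)) (ℚ.*-zeroˡ (h u + - 1ℚ * h' u))
  difference≡0 : ⟪ h ∣ p ⟫ + - 1ℚ * ⟪ h' ∣ p ⟫ ≡ 0ℚ
  difference≡0 = trans (sym (⟪⟫-+* h (- 1ℚ) h' p)) (⟪⟫-null p vanishes)

linear-cong-on-support : ∀ {P : Word → Set} → Decidable P → ∀ {f g} p →
  (∀ u → ¬ P u → coeff p u ≡ 0ℚ) → (∀ u → P u → f u ≋ g u) → linear f p ≈ linear g p
linear-cong-on-support P? {f} {g} p p⊆P f≋g x = begin
  coeff (linear f p) x           ≡⟨ coeff≡⟪⟫ (linear f p) x ⟩
  ⟪ δx ∣ linear f p ⟫            ≡⟨ ⟪⟫-linear δx f p ⟩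
  ⟪ (λ u → ⟪ δx ∣ f u ⟫) ∣ p ⟫   ≡⟨ ⟪⟫-on-support P? p p⊆P (λ u Pu → f≋g u Pu δx) ⟩
  ⟪ (λ u → ⟪ δx ∣ g u ⟫) ∣ p ⟫   ≡⟨ sym (⟪⟫-linear δx g p) ⟩
  ⟪ δx ∣ linear g p ⟫            ≡⟨ sym (coeff≡⟪⟫ (linear g p) x) ⟩
  coeff (linear g p) x           ∎
  where
  δx : Word → ℚ
  δx v = coeff (word v) x

swapL-involutive : ∀ a → swapL (swapL a) ≡ a
swapL-involutive x₀ = refl
swapL-involutive x₁ = refl

τW-++ : ∀ u v → τW (u ++ v) ≡ τW v ++ τW u
τW-++ u v = trans (cong reverse (map-++ swapL u v)) (reverse-++ (map swapL u) (map swapL v))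

τW-∷ : ∀ y u → τW (y ∷ u) ≡ τW u ++ [ swapL y ]
τW-∷ y u = τW-++ [ y ] u

τW-involutive : ∀ u → τW (τW u) ≡ u
τW-involutive u = begin
  reverse (map swapL (reverse (map swapL u)))   ≡⟨ cong reverse (reverse-map swapL (map swapL u)) ⟩
  reverse (reverse (map swapL (map swapL u)))   ≡⟨ reverse-involutive _ ⟩
  map swapL (map swapL u)                       ≡⟨ trans (sym (map-∘ u)) (map-cong swapL-involutive u) ⟩
  map (λ a → a) u                               ≡⟨ map-id u ⟩
  u                                             ∎

flipL : Maybe Letter → Maybe Letter
flipL = Maybe.map swapL

flipL-involutive : ∀ l → flipL (flipL l) ≡ l
flipL-involutive nothing  = refl
flipL-involutive (just a) = cong just (swapL-involutive a)

-- Weighted insertion sums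

Weight : Set
Weight = Maybe Letter → Maybe Letter → ℚ

-- insertions s w l u r = Σ w(a , b) · u₁ s u₂ over all factorisations u = u₁ u₂, where a is
-- the last letter of u₁ and b the first letter of u₂; at the ends of u the neighbours are
-- l and r, nothing standing for the boundary of the word.
insertions : Word → Weight → Maybe Letter → Word → Maybe Letter → Poly
insertions s w l []      r = [ (w l r , s) ]
insertions s w l (y ∷ u) r =
  (w l (just y) , s ++ y ∷ u) ∷ mapWords (y ∷_) (insertions s w (just y) u r)

⟪⟫-insertions-∷ : ∀ h s w l y u r →
  ⟪ h ∣ insertions s w l (y ∷ u) r ⟫
    ≡ w l (just y) * h (s ++ y ∷ u) + ⟪ h ∘ (y ∷_) ∣ insertions s w (just y) u r ⟫
⟪⟫-insertions-∷ h s w l y u r =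
  cong (w l (just y) * h (s ++ y ∷ u) +_) (⟪⟫-mapWords h (y ∷_) (insertions s w (just y) u r))

insertions-cong : ∀ {w w'} → (∀ l r → w l r ≡ w' l r) →
  ∀ s l u r → insertions s w l u r ≡ insertions s w' l u r
insertions-cong w≗w' s l []      r = cong (λ c → [ (c , s) ]) (w≗w' l r)
insertions-cong w≗w' s l (y ∷ u) r =
  cong₂ (λ c p → (c , s ++ y ∷ u) ∷ mapWords (y ∷_) p)
        (w≗w' l (just y)) (insertions-cong w≗w' s (just y) u r)

insertions-context : ∀ {w l l'} → (∀ r → w l r ≡ w l' r) →
  ∀ s u r → insertions s w l u r ≡ insertions s w l' u r
insertions-context     w≗ s []      r = cong (λ c → [ (c , s) ]) (w≗ r)
insertions-context {w} w≗ s (y ∷ u) r =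
  cong (λ c → (c , s ++ y ∷ u) ∷ mapWords (y ∷_) (insertions s w (just y) u r)) (w≗ (just y))

insertions-+ : ∀ {w₁ w₂ w} → (∀ l r → w₁ l r + w₂ l r ≡ w l r) → ∀ h s l u r →
  ⟪ h ∣ insertions s w₁ l u r ⟫ + ⟪ h ∣ insertions s w₂ l u r ⟫ ≡ ⟪ h ∣ insertions s w l u r ⟫
insertions-+ {w₁} {w₂} {w} w₁+w₂≡w h s l [] r =
  trans (collect (w₁ l r) (w₂ l r) (h s) 0ℚ 0ℚ) (cong (λ c → c * h s + (0ℚ + 0ℚ)) (w₁+w₂≡w l r))
  where
  collect : ∀ a b x s t → (a * x + s) + (b * x + t) ≡ (a + b) * x + (s + t)
  collect = solve-∀ ℚ-ring
insertions-+ {w₁} {w₂} {w} w₁+w₂≡w h s l (y ∷ u) r = begin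
  ⟪ h ∣ insertions s w₁ l (y ∷ u) r ⟫ + ⟪ h ∣ insertions s w₂ l (y ∷ u) r ⟫
    ≡⟨ cong₂ _+_ (⟪⟫-insertions-∷ h s w₁ l y u r) (⟪⟫-insertions-∷ h s w₂ l y u r) ⟩
  (w₁ l (just y) * H + T w₁) + (w₂ l (just y) * H + T w₂)
    ≡⟨ collect (w₁ l (just y)) (w₂ l (just y)) H (T w₁) (T w₂) ⟩
  (w₁ l (just y) + w₂ l (just y)) * H + (T w₁ + T w₂)
    ≡⟨ cong₂ (λ c t → c * H + t) (w₁+w₂≡w l (just y))
                                  (insertions-+ w₁+w₂≡w (h ∘ (y ∷_)) s (just y) u r) ⟩
  w l (just y) * H + T w
    ≡⟨ sym (⟪⟫-insertions-∷ h s w l y u r) ⟩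
  ⟪ h ∣ insertions s w l (y ∷ u) r ⟫ ∎
  where
  H : ℚ
  H = h (s ++ y ∷ u)
  T : Weight → ℚ
  T v = ⟪ h ∘ (y ∷_) ∣ insertions s v (just y) u r ⟫
  collect : ∀ a b x s t → (a * x + s) + (b * x + t) ≡ (a + b) * x + (s + t)
  collect = solve-∀ ℚ-ring

insertions-∷ʳ : ∀ h s w l u y r →
  ⟪ h ∣ insertions s w l (u ++ [ y ]) r ⟫
    ≡ ⟪ h ∘ (_++ [ y ]) ∣ insertions s w l u (just y) ⟫ + w (just y) r * h (u ++ y ∷ s)
insertions-∷ʳ h s w l [] y r = regroup (w l (just y) * h (s ++ [ y ])) (w (just y) r * h (y ∷ s))
  where
  regroup : ∀ a b → a + (b + 0ℚ) ≡ (a + 0ℚ) + b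
  regroup = solve-∀ ℚ-ring
insertions-∷ʳ h s w l (x ∷ u) y r = begin
  ⟪ h ∣ insertions s w l (x ∷ u ++ [ y ]) r ⟫
    ≡⟨ ⟪⟫-insertions-∷ h s w l x (u ++ [ y ]) r ⟩
  w l (just x) * h (s ++ x ∷ u ++ [ y ]) + ⟪ h ∘ (x ∷_) ∣ insertions s w (just x) (u ++ [ y ]) r ⟫
    ≡⟨ cong₂ (λ v t → w l (just x) * h v + t) (sym (++-assoc s (x ∷ u) [ y ]))
             (insertions-∷ʳ (h ∘ (x ∷_)) s w (just x) u y r) ⟩
  G + (T + E)  ≡⟨ sym (ℚ.+-assoc G T E) ⟩
  (G + T) + E  ≡⟨ cong (_+ E) (sym (⟪⟫-insertions-∷ (h ∘ (_++ [ y ])) s w l x u (just y))) ⟩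
  ⟪ h ∘ (_++ [ y ]) ∣ insertions s w l (x ∷ u) (just y) ⟫ + E ∎
  where
  G T E : ℚ
  G = w l (just x) * h ((s ++ x ∷ u) ++ [ y ])
  T = ⟪ h ∘ (_++ [ y ]) ∘ (x ∷_) ∣ insertions s w (just x) u (just y) ⟫
  E = w (just y) r * h (x ∷ u ++ y ∷ s)

infix 10 _ᵀ
_ᵀ : Weight → Weight
(w ᵀ) l r = w (flipL r) (flipL l)

insertions-τ : ∀ h s w l u r →
  ⟪ h ∘ τW ∣ insertions s w l u r ⟫ ≡ ⟪ h ∣ insertions (τW s) (w ᵀ) (flipL r) (τW u) (flipL l) ⟫
insertions-τ h s w l [] r =
  cong (λ c → c * h (τW s) + 0ℚ) (sym (cong₂ w (flipL-involutive l) (flipL-involutive r)))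
insertions-τ h s w l (y ∷ u) r = begin
  ⟪ h ∘ τW ∣ insertions s w l (y ∷ u) r ⟫
    ≡⟨ ⟪⟫-insertions-∷ (h ∘ τW) s w l y u r ⟩
  w l (just y) * h (τW (s ++ y ∷ u)) + ⟪ h ∘ τW ∘ (y ∷_) ∣ insertions s w (just y) u r ⟫
    ≡⟨ cong₂ _+_ gap rest ⟩
  G + T
    ≡⟨ ℚ.+-comm G T ⟩
  T + G
    ≡⟨ sym (insertions-∷ʳ h (τW s) (w ᵀ) (flipL r) (τW u) y′ (flipL l)) ⟩
  ⟪ h ∣ insertions (τW s) (w ᵀ) (flipL r) (τW u ++ [ y′ ]) (flipL l) ⟫
    ≡⟨ cong (λ v → ⟪ h ∣ insertions (τW s) (w ᵀ) (flipL r) v (flipL l) ⟫) (sym (τW-∷ y u)) ⟩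
  ⟪ h ∣ insertions (τW s) (w ᵀ) (flipL r) (τW (y ∷ u)) (flipL l) ⟫ ∎
  where
  y′ : Letter
  y′ = swapL y
  G T : ℚ
  G = (w ᵀ) (just y′) (flipL l) * h (τW u ++ y′ ∷ τW s)
  T = ⟪ h ∘ (_++ [ y′ ]) ∣ insertions (τW s) (w ᵀ) (flipL r) (τW u) (just y′) ⟫
  gap : w l (just y) * h (τW (s ++ y ∷ u)) ≡ G
  gap = cong₂ (λ c v → c * h v)
    (sym (cong₂ w (flipL-involutive l) (cong just (swapL-involutive y))))
    (begin
      τW (s ++ y ∷ u)              ≡⟨ τW-++ s (y ∷ u) ⟩
      τW (y ∷ u) ++ τW s           ≡⟨ cong (_++ τW s) (τW-∷ y u) ⟩
      (τW u ++ [ y′ ]) ++ τW s     ≡⟨ ++-assoc (τW u) [ y′ ] (τW s) ⟩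
      τW u ++ y′ ∷ τW s            ∎)
  rest : ⟪ h ∘ τW ∘ (y ∷_) ∣ insertions s w (just y) u r ⟫ ≡ T
  rest = trans (⟪⟫-cong (λ v → cong h (τW-∷ y v)) (insertions s w (just y) u r))
               (insertions-τ (h ∘ (_++ [ y′ ])) s w (just y) u r)

isX₀ notX₀ isX₁ notX₁ : Maybe Letter → ℚ
isX₀ (just x₀) = 1ℚ
isX₀ _         = 0ℚ
notX₀ (just x₀) = 0ℚ
notX₀ _         = 1ℚ
isX₁ (just x₁) = 1ℚ
isX₁ _         = 0ℚ
notX₁ (just x₁) = 0ℚ
notX₁ _         = 1ℚ

afterX₀ notAfterX₀ beforeX₁ notBeforeX₁ : Weight
afterX₀     l _ = isX₀ l
notAfterX₀  l _ = notX₀ l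
beforeX₁    _ r = isX₁ r
notBeforeX₁ _ r = notX₁ r

afterX₀+notAfterX₀ : ∀ l r → afterX₀ l r + notAfterX₀ l r ≡ 1ℚ
afterX₀+notAfterX₀ nothing   _ = refl
afterX₀+notAfterX₀ (just x₀) _ = refl
afterX₀+notAfterX₀ (just x₁) _ = refl

notBeforeX₁+beforeX₁ : ∀ l r → notBeforeX₁ l r + beforeX₁ l r ≡ 1ℚ
notBeforeX₁+beforeX₁ _ nothing   = refl
notBeforeX₁+beforeX₁ _ (just x₀) = refl
notBeforeX₁+beforeX₁ _ (just x₁) = refl

notAfterX₀ᵀ : ∀ l r → (notAfterX₀ ᵀ) l r ≡ notBeforeX₁ l r
notAfterX₀ᵀ _ nothing   = refl
notAfterX₀ᵀ _ (just x₀) = refl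
notAfterX₀ᵀ _ (just x₁) = refl

beforeX₁ᵀ : ∀ l r → (beforeX₁ ᵀ) l r ≡ afterX₀ l r
beforeX₁ᵀ nothing   _ = refl
beforeX₁ᵀ (just x₀) _ = refl
beforeX₁ᵀ (just x₁) _ = refl

-- ∂₂ as an insertion sum

x₀x₀ x₁x₁ : Word
x₀x₀ = x₀ ∷ x₀ ∷ []
x₁x₁ = x₁ ∷ x₁ ∷ []

sign : Letter → ℚ
sign x₀ = 1ℚ
sign x₁ = - 1ℚ

⟪⟫-∂₂W-∷ : ∀ h y u → ⟪ h ∣ ∂₂W (y ∷ u) ⟫
  ≡ sign y * (h (x₀ ∷ x₀ ∷ x₁ ∷ u) + h (x₀ ∷ x₁ ∷ x₁ ∷ u)) + ⟪ h ∘ (y ∷_) ∣ ∂₂W u ⟫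
⟪⟫-∂₂W-∷ h y u = trans (⟪⟫-++ h (∂₂L y · word u) (word [ y ] · ∂₂W u))
  (cong₂ _+_ (⟪⟫-∂₂L y) (⟪⟫-word· h [ y ] (∂₂W u)))
  where
  factor : ∀ c a b → c * a + (c * b + 0ℚ) ≡ c * (a + b)
  factor = solve-∀ ℚ-ring
  ⟪⟫-∂₂L : ∀ y → ⟪ h ∣ ∂₂L y · word u ⟫ ≡ sign y * (h (x₀ ∷ x₀ ∷ x₁ ∷ u) + h (x₀ ∷ x₁ ∷ x₁ ∷ u))
  ⟪⟫-∂₂L x₀ = factor 1ℚ     (h (x₀ ∷ x₀ ∷ x₁ ∷ u)) (h (x₀ ∷ x₁ ∷ x₁ ∷ u))
  ⟪⟫-∂₂L x₁ = factor (- 1ℚ) (h (x₀ ∷ x₀ ∷ x₁ ∷ u)) (h (x₀ ∷ x₁ ∷ x₁ ∷ u))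

-- The gap in front of y: ∂₂(x₀) = x₀ (x₀x₁ + x₁x₁) is what is inserted after x₀, and
-- ∂₂(x₁) = - (x₀x₀ + x₀x₁) x₁ what is removed before x₁.
∂₂L-gap : ∀ (h : Word → ℚ) y u →
  isX₀ (just y) * (h (y ∷ x₀ ∷ x₁ ∷ u) + h (y ∷ x₁ ∷ x₁ ∷ u))
    ≡ isX₁ (just y) * (h (x₀ ∷ x₀ ∷ y ∷ u) + h (x₀ ∷ x₁ ∷ y ∷ u))
      + sign y * (h (x₀ ∷ x₀ ∷ x₁ ∷ u) + h (x₀ ∷ x₁ ∷ x₁ ∷ u))
∂₂L-gap h x₀ u = after (h (x₀ ∷ x₀ ∷ x₁ ∷ u)) (h (x₀ ∷ x₁ ∷ x₁ ∷ u))
                       (h (x₀ ∷ x₀ ∷ x₀ ∷ u)) (h (x₀ ∷ x₁ ∷ x₀ ∷ u))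
  where
  after : ∀ a b c d → 1ℚ * (a + b) ≡ 0ℚ * (c + d) + 1ℚ * (a + b)
  after = solve-∀ ℚ-ring
∂₂L-gap h x₁ u = before (h (x₀ ∷ x₀ ∷ x₁ ∷ u)) (h (x₀ ∷ x₁ ∷ x₁ ∷ u))
                        (h (x₁ ∷ x₀ ∷ x₁ ∷ u)) (h (x₁ ∷ x₁ ∷ x₁ ∷ u))
  where
  before : ∀ a b c d → 0ℚ * (c + d) ≡ 1ℚ * (a + b) + - 1ℚ * (a + b)
  before = solve-∀ ℚ-ring

∂₂W-insertions : ∀ h l u →
  ⟪ h ∣ insertions (z 2) afterX₀ l u nothing ⟫ + ⟪ h ∣ insertions x₁x₁ afterX₀ l u nothing ⟫
    ≡ ⟪ h ∣ insertions x₀x₀ beforeX₁ l u nothing ⟫ + ⟪ h ∣ insertions (z 2) beforeX₁ l u nothing ⟫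
      + isX₀ l * (h (x₀ ∷ x₁ ∷ u) + h (x₁ ∷ x₁ ∷ u)) + ⟪ h ∣ ∂₂W u ⟫
∂₂W-insertions h l [] = ends (isX₀ l) (h (z 2)) (h x₁x₁) (h x₀x₀)
  where
  ends : ∀ a p q r → (a * p + 0ℚ) + (a * q + 0ℚ) ≡ (0ℚ * r + 0ℚ) + (0ℚ * p + 0ℚ) + a * (p + q) + 0ℚ
  ends = solve-∀ ℚ-ring
∂₂W-insertions h l (y ∷ u) = begin
  ⟪ h ∣ insertions (z 2) afterX₀ l (y ∷ u) nothing ⟫ + ⟪ h ∣ insertions x₁x₁ afterX₀ l (y ∷ u) nothing ⟫
    ≡⟨ cong₂ _+_ (⟪⟫-insertions-∷ h (z 2) afterX₀ l y u nothing)
                 (⟪⟫-insertions-∷ h x₁x₁ afterX₀ l y u nothing) ⟩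
  (a * P + T (z 2) afterX₀) + (a * Q + T x₁x₁ afterX₀)
    ≡⟨ regroup₁ a P Q _ _ ⟩
  a * (P + Q) + (T (z 2) afterX₀ + T x₁x₁ afterX₀)
    ≡⟨ cong (a * (P + Q) +_) (∂₂W-insertions (h ∘ (y ∷_)) (just y) u) ⟩
  a * (P + Q) + (T x₀x₀ beforeX₁ + T (z 2) beforeX₁
                   + isX₀ (just y) * (h (y ∷ x₀ ∷ x₁ ∷ u) + h (y ∷ x₁ ∷ x₁ ∷ u)) + D)
    ≡⟨ cong (λ g → a * (P + Q) + (T x₀x₀ beforeX₁ + T (z 2) beforeX₁ + g + D)) (∂₂L-gap h y u) ⟩
  a * (P + Q) + (T x₀x₀ beforeX₁ + T (z 2) beforeX₁ + (b * (R + P) + S) + D)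
    ≡⟨ regroup₂ a b P Q R S _ _ D ⟩
  (b * R + T x₀x₀ beforeX₁) + (b * P + T (z 2) beforeX₁) + a * (P + Q) + (S + D)
    ≡⟨ sym (cong₂ (λ m n → m + n + a * (P + Q) + (S + D))
                  (⟪⟫-insertions-∷ h x₀x₀ beforeX₁ l y u nothing)
                  (⟪⟫-insertions-∷ h (z 2) beforeX₁ l y u nothing)) ⟩
  I x₀x₀ beforeX₁ + I (z 2) beforeX₁ + a * (P + Q) + (S + D)
    ≡⟨ cong (I x₀x₀ beforeX₁ + I (z 2) beforeX₁ + a * (P + Q) +_) (sym (⟪⟫-∂₂W-∷ h y u)) ⟩
  I x₀x₀ beforeX₁ + I (z 2) beforeX₁ + a * (P + Q) + ⟪ h ∣ ∂₂W (y ∷ u) ⟫ ∎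
  where
  a b P Q R S D : ℚ
  a = isX₀ l
  b = isX₁ (just y)
  P = h (x₀ ∷ x₁ ∷ y ∷ u)
  Q = h (x₁ ∷ x₁ ∷ y ∷ u)
  R = h (x₀ ∷ x₀ ∷ y ∷ u)
  S = sign y * (h (x₀ ∷ x₀ ∷ x₁ ∷ u) + h (x₀ ∷ x₁ ∷ x₁ ∷ u))
  D = ⟪ h ∘ (y ∷_) ∣ ∂₂W u ⟫
  I : Word → Weight → ℚ
  I s w = ⟪ h ∣ insertions s w l (y ∷ u) nothing ⟫
  T : Word → Weight → ℚ
  T s w = ⟪ h ∘ (y ∷_) ∣ insertions s w (just y) u nothing ⟫
  regroup₁ : ∀ a p q s t → (a * p + s) + (a * q + t) ≡ a * (p + q) + (s + t)
  regroup₁ = solve-∀ ℚ-ring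
  regroup₂ : ∀ a b p q r k s t d →
    a * (p + q) + (s + t + (b * (r + p) + k) + d) ≡ (b * r + s) + (b * p + t) + a * (p + q) + (k + d)
  regroup₂ = solve-∀ ℚ-ring

-- The quasi-shuffle with z₂ as an insertion sum

-- zWord (k₁ ∷ … ∷ kₙ) = z_{k₁+1} ⋯ z_{kₙ+1}; the shift lets every index list denote a word of 𝔥¹.
zWord : List ℕ → Word
zWord ks = concatMap z (map suc ks)

parseZ-replicate-x₀ : ∀ k n w → parseZ n (replicate k x₀ ++ w) ≡ parseZ (k +ℕ n) w
parseZ-replicate-x₀ zero    n       w = refl
parseZ-replicate-x₀ (suc k) zero    w =
  trans (parseZ-replicate-x₀ k 1 w) (cong (λ m → parseZ m w) (+-suc k 0))
parseZ-replicate-x₀ (suc k) (suc n) w =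
  trans (parseZ-replicate-x₀ k (suc (suc n)) w) (cong (λ m → parseZ m w) (+-suc k (suc n)))

parseZ-x₁ : ∀ n {w ks} → parseZ zero w ≡ just ks → parseZ n (x₁ ∷ w) ≡ just (suc n ∷ ks)
parseZ-x₁ zero    {w} w↦ks rewrite w↦ks = refl
parseZ-x₁ (suc n) {w} w↦ks rewrite w↦ks = refl

parseZ-zWord : ∀ ks → parseZ zero (zWord ks) ≡ just (map suc ks)
parseZ-zWord []       = refl
parseZ-zWord (k ∷ ks) = begin
  parseZ zero ((replicate k x₀ ++ [ x₁ ]) ++ zWord ks)
    ≡⟨ cong (parseZ zero) (++-assoc (replicate k x₀) [ x₁ ] (zWord ks)) ⟩
  parseZ zero (replicate k x₀ ++ x₁ ∷ zWord ks)
    ≡⟨ parseZ-replicate-x₀ k zero (x₁ ∷ zWord ks) ⟩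
  parseZ (k +ℕ zero) (x₁ ∷ zWord ks)
    ≡⟨ cong (λ n → parseZ n (x₁ ∷ zWord ks)) (+-identityʳ k) ⟩
  parseZ k (x₁ ∷ zWord ks)
    ≡⟨ parseZ-x₁ k (parseZ-zWord ks) ⟩
  just (suc k ∷ map suc ks) ∎

astW-zWord-z₂ : ∀ ks → astW (zWord ks) (z 2) ≡ qsh (map suc ks) (2 ∷ [])
astW-zWord-z₂ ks with parseZ zero (zWord ks) | parseZ-zWord ks
... | just .(map suc ks) | refl = refl

qsh-[] : ∀ ks → qsh ks [] ≡ word (concatMap z ks)
qsh-[] []       = refl
qsh-[] (k ∷ ks) = refl

replicate-x₀-++-x₀x₀ : ∀ k u → replicate k x₀ ++ x₀ ∷ x₀ ∷ x₁ ∷ u ≡ z (suc k +ℕ 2) ++ u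
replicate-x₀-++-x₀x₀ zero    u = refl
replicate-x₀-++-x₀x₀ (suc k) u = cong (x₀ ∷_) (replicate-x₀-++-x₀x₀ k u)

⟪⟫-insertions-notAfterX₀-z : ∀ h s l k u r →
  ⟪ h ∣ insertions s notAfterX₀ l (z (suc k) ++ u) r ⟫
    ≡ notX₀ l * h (s ++ z (suc k) ++ u) + ⟪ h ∘ (z (suc k) ++_) ∣ insertions s notAfterX₀ nothing u r ⟫
⟪⟫-insertions-notAfterX₀-z h s l zero u r =
  trans (⟪⟫-insertions-∷ h s notAfterX₀ l x₁ u r)
        (cong (λ p → notX₀ l * h (s ++ x₁ ∷ u) + ⟪ h ∘ (x₁ ∷_) ∣ p ⟫)
              (insertions-context (λ _ → refl) s u r))
⟪⟫-insertions-notAfterX₀-z h s l (suc k) u r =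
  trans (⟪⟫-insertions-∷ h s notAfterX₀ l x₀ (z (suc k) ++ u) r)
        (cong (notX₀ l * h (s ++ x₀ ∷ z (suc k) ++ u) +_)
              (trans (⟪⟫-insertions-notAfterX₀-z (h ∘ (x₀ ∷_)) s (just x₀) k u r)
                     (absorb (h (x₀ ∷ s ++ z (suc k) ++ u)) _)))
  where
  absorb : ∀ a b → 0ℚ * a + b ≡ b
  absorb = solve-∀ ℚ-ring

⟪⟫-insertions-beforeX₁-z : ∀ h s l k u r →
  ⟪ h ∣ insertions s beforeX₁ l (z (suc k) ++ u) r ⟫
    ≡ 1ℚ * h (replicate k x₀ ++ s ++ x₁ ∷ u) + ⟪ h ∘ (z (suc k) ++_) ∣ insertions s beforeX₁ nothing u r ⟫
⟪⟫-insertions-beforeX₁-z h s l zero u r =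
  trans (⟪⟫-insertions-∷ h s beforeX₁ l x₁ u r)
        (cong (λ p → 1ℚ * h (s ++ x₁ ∷ u) + ⟪ h ∘ (x₁ ∷_) ∣ p ⟫)
              (insertions-context (λ _ → refl) s u r))
⟪⟫-insertions-beforeX₁-z h s l (suc k) u r =
  trans (⟪⟫-insertions-∷ h s beforeX₁ l x₀ (z (suc k) ++ u) r)
        (trans (cong (0ℚ * h (s ++ x₀ ∷ z (suc k) ++ u) +_)
                     (⟪⟫-insertions-beforeX₁-z (h ∘ (x₀ ∷_)) s (just x₀) k u r))
               (absorb (h (s ++ x₀ ∷ z (suc k) ++ u)) _))
  where
  absorb : ∀ a b → 0ℚ * a + b ≡ b
  absorb = solve-∀ ℚ-ring

⟪⟫-qsh-z₂ : ∀ h ks →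
  ⟪ h ∣ qsh (map suc ks) (2 ∷ []) ⟫
    ≡ ⟪ h ∣ insertions (z 2) notAfterX₀ nothing (zWord ks) nothing ⟫
      + ⟪ h ∣ insertions x₀x₀ beforeX₁ nothing (zWord ks) nothing ⟫
⟪⟫-qsh-z₂ h [] = ends (h (z 2)) (h x₀x₀)
  where
  ends : ∀ a b → 1ℚ * a + 0ℚ ≡ (1ℚ * a + 0ℚ) + (0ℚ * b + 0ℚ)
  ends = solve-∀ ℚ-ring
⟪⟫-qsh-z₂ h (k ∷ ks) = begin
  ⟪ h ∣ X ⊕ Y ⊕ Z ⟫
    ≡⟨ trans (⟪⟫-++ h (X ⊕ Y) Z) (cong (_+ ⟪ h ∣ Z ⟫) (⟪⟫-++ h X Y)) ⟩
  ⟪ h ∣ X ⟫ + ⟪ h ∣ Y ⟫ + ⟪ h ∣ Z ⟫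
    ≡⟨ cong₂ (λ a b → a + ⟪ h ∣ Y ⟫ + b)
             (trans (⟪⟫-mapWords h (z (suc k) ++_) (qsh (map suc ks) (2 ∷ [])))
                    (⟪⟫-qsh-z₂ (h ∘ (z (suc k) ++_)) ks))
             (trans (cong (λ p → ⟪ h ∣ zPrefix (suc k +ℕ 2) p ⟫) (qsh-[] (map suc ks)))
                    (cong (λ v → 1ℚ * h v + 0ℚ) (sym (replicate-x₀-++-x₀x₀ k (zWord ks))))) ⟩
  (N + B) + (1ℚ * p + 0ℚ) + (1ℚ * q + 0ℚ)
    ≡⟨ regroup N B p q ⟩
  (1ℚ * p + N) + (1ℚ * q + B)
    ≡⟨ sym (cong₂ _+_ (⟪⟫-insertions-notAfterX₀-z h (z 2) nothing k (zWord ks) nothing)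
                      (⟪⟫-insertions-beforeX₁-z h x₀x₀ nothing k (zWord ks) nothing)) ⟩
  ⟪ h ∣ insertions (z 2) notAfterX₀ nothing (zWord (k ∷ ks)) nothing ⟫
    + ⟪ h ∣ insertions x₀x₀ beforeX₁ nothing (zWord (k ∷ ks)) nothing ⟫ ∎
  where
  X Y Z : Poly
  X = zPrefix (suc k) (qsh (map suc ks) (2 ∷ []))
  Y = zPrefix 2 (qsh (map suc (k ∷ ks)) [])
  Z = zPrefix (suc k +ℕ 2) (qsh (map suc ks) [])
  p q : ℚ
  p = h (x₀ ∷ x₁ ∷ zWord (k ∷ ks))
  q = h (replicate k x₀ ++ x₀ ∷ x₀ ∷ x₁ ∷ zWord ks)
  N B : ℚ
  N = ⟪ h ∘ (z (suc k) ++_) ∣ insertions (z 2) notAfterX₀ nothing (zWord ks) nothing ⟫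
  B = ⟪ h ∘ (z (suc k) ++_) ∣ insertions x₀x₀ beforeX₁ nothing (zWord ks) nothing ⟫
  regroup : ∀ n b p q → n + b + (1ℚ * p + 0ℚ) + (1ℚ * q + 0ℚ) ≡ (1ℚ * p + n) + (1ℚ * q + b)
  regroup = solve-∀ ℚ-ring

⟪⟫-∗z₂ : ∀ h u ks → u ≡ zWord ks →
  ⟪ h ∣ astW u (z 2) ⟫
    ≡ ⟪ h ∣ insertions (z 2) notAfterX₀ nothing u nothing ⟫
      + ⟪ h ∣ insertions x₀x₀ beforeX₁ nothing u nothing ⟫
⟪⟫-∗z₂ h .(zWord ks) ks refl = trans (cong ⟪ h ∣_⟫ (astW-zWord-z₂ ks)) (⟪⟫-qsh-z₂ h ks)

⟪⟫-□z₂ : ∀ h u ks → τW u ≡ zWord ks →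
  ⟪ h ∣ τ (astW (τW u) (z 2)) ⟫
    ≡ ⟪ h ∣ insertions (z 2) notBeforeX₁ nothing u nothing ⟫
      + ⟪ h ∣ insertions x₁x₁ afterX₀ nothing u nothing ⟫
⟪⟫-□z₂ h u ks τu≡ = begin
  ⟪ h ∣ τ (astW (τW u) (z 2)) ⟫
    ≡⟨ ⟪⟫-mapWords h τW (astW (τW u) (z 2)) ⟩
  ⟪ h ∘ τW ∣ astW (τW u) (z 2) ⟫
    ≡⟨ ⟪⟫-∗z₂ (h ∘ τW) (τW u) ks τu≡ ⟩
  ⟪ h ∘ τW ∣ insertions (z 2) notAfterX₀ nothing (τW u) nothing ⟫
    + ⟪ h ∘ τW ∣ insertions x₀x₀ beforeX₁ nothing (τW u) nothing ⟫
    ≡⟨ cong₂ _+_ (insertions-τ h (z 2) notAfterX₀ nothing (τW u) nothing)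
                 (insertions-τ h x₀x₀ beforeX₁ nothing (τW u) nothing) ⟩
  ⟪ h ∣ insertions (z 2) (notAfterX₀ ᵀ) nothing (τW (τW u)) nothing ⟫
    + ⟪ h ∣ insertions x₁x₁ (beforeX₁ ᵀ) nothing (τW (τW u)) nothing ⟫
    ≡⟨ cong (λ v → ⟪ h ∣ insertions (z 2) (notAfterX₀ ᵀ) nothing v nothing ⟫
                   + ⟪ h ∣ insertions x₁x₁ (beforeX₁ ᵀ) nothing v nothing ⟫)
            (τW-involutive u) ⟩
  ⟪ h ∣ insertions (z 2) (notAfterX₀ ᵀ) nothing u nothing ⟫
    + ⟪ h ∣ insertions x₁x₁ (beforeX₁ ᵀ) nothing u nothing ⟫
    ≡⟨ cong₂ (λ p q → ⟪ h ∣ p ⟫ + ⟪ h ∣ q ⟫)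
             (insertions-cong notAfterX₀ᵀ (z 2) nothing u nothing)
             (insertions-cong beforeX₁ᵀ x₁x₁ nothing u nothing) ⟩
  ⟪ h ∣ insertions (z 2) notBeforeX₁ nothing u nothing ⟫
    + ⟪ h ∣ insertions x₁x₁ afterX₀ nothing u nothing ⟫ ∎

-- Words of 𝔥⁰

InH0W? : Decidable InH0W
InH0W? []       = yes (inj₁ refl)
InH0W? (x₁ ∷ u) = no λ { (inj₁ ()) ; (inj₂ (_ , ())) }
InH0W? (x₀ ∷ u) with initLast u
... | []       = no λ { (inj₁ ()) ; (inj₂ ([] , ())) ; (inj₂ (_ ∷ _ , ())) }
... | v ∷ʳ′ x₁ = yes (inj₂ (v , refl))
... | v ∷ʳ′ x₀ = no λ { (inj₁ ())
                     ; (inj₂ (v′ , e)) → x₀≢x₁ (proj₂ (∷ʳ-injective v v′ (∷-injectiveʳ e))) }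
  where
  x₀≢x₁ : x₀ ≢ x₁
  x₀≢x₁ ()

∷ʳx₁-zWord : ∀ v → ∃₂ λ k ks → v ++ [ x₁ ] ≡ zWord (k ∷ ks)
∷ʳx₁-zWord []       = 0 , [] , refl
∷ʳx₁-zWord (x₀ ∷ v) with k , ks , e ← ∷ʳx₁-zWord v = suc k , ks , cong (x₀ ∷_) e
∷ʳx₁-zWord (x₁ ∷ v) with k , ks , e ← ∷ʳx₁-zWord v = 0 , k ∷ ks , cong (x₁ ∷_) e

h⁰-zWord : ∀ {u} → InH0W u → ∃ λ ks → u ≡ zWord ks
h⁰-zWord (inj₁ refl)       = [] , refl
h⁰-zWord (inj₂ (v , refl)) with k , ks , e ← ∷ʳx₁-zWord (x₀ ∷ v) = k ∷ ks , e

h⁰-τW : ∀ {u} → InH0W u → InH0W (τW u)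
h⁰-τW (inj₁ refl)       = inj₁ refl
h⁰-τW (inj₂ (v , refl)) =
  inj₂ (τW v , trans (τW-∷ x₀ (v ++ [ x₁ ])) (cong (_++ [ x₁ ]) (τW-++ v [ x₁ ])))

□⊖∗z₂ : Word → Poly
□⊖∗z₂ u = τ (astW (τW u) (z 2)) ⊖ astW u (z 2)

∂₂W-□⊖∗z₂ : ∀ u → InH0W u → ∂₂W u ≋ □⊖∗z₂ u
∂₂W-□⊖∗z₂ u u∈h⁰ h = begin
  ⟪ h ∣ ∂₂W u ⟫
    ≡⟨ isolate A₀₁ A₁₁ B₀₀ B₀₁ (∂₂W-insertions h nothing u) ⟩
  (A₀₁ + A₁₁) + - 1ℚ * (B₀₀ + B₀₁)
    ≡⟨ regroup₁ A₀₁ A₁₁ B₀₀ B₀₁ M₀₁ ⟩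
  (A₀₁ + M₀₁) + A₁₁ + - 1ℚ * (M₀₁ + B₀₀ + B₀₁)
    ≡⟨ cong (λ a → a + A₁₁ + - 1ℚ * (M₀₁ + B₀₀ + B₀₁)) complement ⟩
  (N₀₁ + B₀₁) + A₁₁ + - 1ℚ * (M₀₁ + B₀₀ + B₀₁)
    ≡⟨ regroup₂ N₀₁ B₀₁ A₁₁ M₀₁ B₀₀ ⟩
  (N₀₁ + A₁₁) + - 1ℚ * (M₀₁ + B₀₀)
    ≡⟨ sym (cong₂ (λ a b → a + - 1ℚ * b) (⟪⟫-□z₂ h u (proj₁ τu-blocks) (proj₂ τu-blocks))
                                          (⟪⟫-∗z₂ h u (proj₁ u-blocks) (proj₂ u-blocks))) ⟩
  ⟪ h ∣ τ (astW (τW u) (z 2)) ⟫ + - 1ℚ * ⟪ h ∣ astW u (z 2) ⟫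
    ≡⟨ sym (⟪⟫-⊖ h (τ (astW (τW u) (z 2))) (astW u (z 2))) ⟩
  ⟪ h ∣ □⊖∗z₂ u ⟫ ∎
  where
  I : Word → Weight → ℚ
  I s w = ⟪ h ∣ insertions s w nothing u nothing ⟫
  A₀₁ A₁₁ B₀₀ B₀₁ M₀₁ N₀₁ : ℚ
  A₀₁ = I (z 2) afterX₀
  A₁₁ = I x₁x₁ afterX₀
  B₀₀ = I x₀x₀ beforeX₁
  B₀₁ = I (z 2) beforeX₁
  M₀₁ = I (z 2) notAfterX₀
  N₀₁ = I (z 2) notBeforeX₁
  complement : A₀₁ + M₀₁ ≡ N₀₁ + B₀₁
  complement = trans (insertions-+ afterX₀+notAfterX₀ h (z 2) nothing u nothing)
                     (sym (insertions-+ notBeforeX₁+beforeX₁ h (z 2) nothing u nothing))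
  u-blocks : ∃ λ ks → u ≡ zWord ks
  u-blocks = h⁰-zWord u∈h⁰
  τu-blocks : ∃ λ ks → τW u ≡ zWord ks
  τu-blocks = h⁰-zWord (h⁰-τW u∈h⁰)
  E : ℚ
  E = h (x₀ ∷ x₁ ∷ u) + h (x₁ ∷ x₁ ∷ u)
  isolate : ∀ a₁ a₂ b₀ b₁ → a₁ + a₂ ≡ b₀ + b₁ + 0ℚ * E + ⟪ h ∣ ∂₂W u ⟫ →
            ⟪ h ∣ ∂₂W u ⟫ ≡ (a₁ + a₂) + - 1ℚ * (b₀ + b₁)
  isolate a₁ a₂ b₀ b₁ balance =
    trans (solve-d (b₀ + b₁) E ⟪ h ∣ ∂₂W u ⟫) (cong (_+ - 1ℚ * (b₀ + b₁)) (sym balance))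
    where
    solve-d : ∀ b k d → d ≡ (b + 0ℚ * k + d) + - 1ℚ * b
    solve-d = solve-∀ ℚ-ring
  regroup₁ : ∀ a₁ a₂ b₀ b₁ m → (a₁ + a₂) + - 1ℚ * (b₀ + b₁) ≡ (a₁ + m) + a₂ + - 1ℚ * (m + b₀ + b₁)
  regroup₁ = solve-∀ ℚ-ring
  regroup₂ : ∀ n b₁ a₂ m b₀ → (n + b₁) + a₂ + - 1ℚ * (m + b₀ + b₁) ≡ (n + a₂) + - 1ℚ * (m + b₀)
  regroup₂ = solve-∀ ℚ-ring

□z₂⊖∗z₂-linear : ∀ w → w □ z₂ ⊖ w ∗ z₂ ≈ linear □⊖∗z₂ w
□z₂⊖∗z₂-linear w = ≋⇒≈ {w □ z₂ ⊖ w ∗ z₂} {linear □⊖∗z₂ w} λ h → begin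
  ⟪ h ∣ w □ z₂ ⊖ w ∗ z₂ ⟫
    ≡⟨ ⟪⟫-⊖ h (w □ z₂) (w ∗ z₂) ⟩
  ⟪ h ∣ τ (τ w ∗ z₂) ⟫ + - 1ℚ * ⟪ h ∣ w ∗ z₂ ⟫
    ≡⟨ cong₂ (λ a b → a + - 1ℚ * b) (□-as-sum h) (⟪⟫-∗word h w (z 2)) ⟩
  ⟪ (λ u → ⟪ h ∣ τ (astW (τW u) (z 2)) ⟫) ∣ w ⟫ + - 1ℚ * ⟪ (λ u → ⟪ h ∣ astW u (z 2) ⟫) ∣ w ⟫
    ≡⟨ sym (⟪⟫-+* (λ u → ⟪ h ∣ τ (astW (τW u) (z 2)) ⟫) (- 1ℚ) (λ u → ⟪ h ∣ astW u (z 2) ⟫) w) ⟩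
  ⟪ (λ u → ⟪ h ∣ τ (astW (τW u) (z 2)) ⟫ + - 1ℚ * ⟪ h ∣ astW u (z 2) ⟫) ∣ w ⟫
    ≡⟨ sym (⟪⟫-cong (λ u → ⟪⟫-⊖ h (τ (astW (τW u) (z 2))) (astW u (z 2))) w) ⟩
  ⟪ (λ u → ⟪ h ∣ τ (astW (τW u) (z 2)) ⊖ astW u (z 2) ⟫) ∣ w ⟫
    ≡⟨ sym (⟪⟫-linear h □⊖∗z₂ w) ⟩
  ⟪ h ∣ linear □⊖∗z₂ w ⟫ ∎
  where
  □-as-sum : ∀ h → ⟪ h ∣ τ (τ w ∗ z₂) ⟫ ≡ ⟪ (λ u → ⟪ h ∣ τ (astW (τW u) (z 2)) ⟫) ∣ w ⟫
  □-as-sum h = begin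
    ⟪ h ∣ τ (τ w ∗ z₂) ⟫
      ≡⟨ ⟪⟫-mapWords h τW (τ w ∗ z₂) ⟩
    ⟪ h ∘ τW ∣ τ w ∗ z₂ ⟫
      ≡⟨ ⟪⟫-∗word (h ∘ τW) (τ w) (z 2) ⟩
    ⟪ (λ u → ⟪ h ∘ τW ∣ astW u (z 2) ⟫) ∣ τ w ⟫
      ≡⟨ ⟪⟫-mapWords (λ u → ⟪ h ∘ τW ∣ astW u (z 2) ⟫) τW w ⟩
    ⟪ (λ u → ⟪ h ∘ τW ∣ astW (τW u) (z 2) ⟫) ∣ w ⟫
      ≡⟨ ⟪⟫-cong (λ u → sym (⟪⟫-mapWords h τW (astW (τW u) (z 2)))) w ⟩
    ⟪ (λ u → ⟪ h ∣ τ (astW (τW u) (z 2)) ⟫) ∣ w ⟫ ∎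

theorem4p4 : ∀ (w : Poly) → InH0 w → ∂₂ w ≈ w □ z₂ ⊖ w ∗ z₂
theorem4p4 w w∈h⁰ x =
  trans (linear-cong-on-support InH0W? {∂₂W} {□⊖∗z₂} w w∈h⁰ ∂₂W-□⊖∗z₂ x)
        (sym (□z₂⊖∗z₂-linear w x))
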